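{- Let $T$ be an interesting set in a graph $G=(V,E)$. Then $G$ has a $T$-outer path if and only if there exists a connected component $R$ of $G[V\setminus(T\cup C(T))]$ such that $N(R)\cap C(T)$ is not a clique.
   Context: All graphs are finite and simple. For $X\subseteq V$, $C(X)$ denotes the set of vertices of $V\setminus X$ adjacent to every vertex of $X$, and $N(X)$ denotes the set of vertices of $V\setminus X$ adjacent to at least one vertex of $X$. A set $X$ is co-connected if the complement of $G[X]$ is connected. A non-empty set $T\subseteq V$ is interesting if $T$ is co-connected and $G[C(T)]$ is not a clique (the empty set counts as a clique). A $T$-outer path is a chordless path whose two endvertices are in $C(T)$ and whose interior vertices all lie in $V\setminus(T\cup C(T))$. -}

module Defs where

open import Data.Nat using (ℕ; zero; suc)
open import Data.Fin using (Fin; toℕ; fromℕ)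
open import Data.Fin.Subset using (Subset; _∈_; _∉_)
open import Data.Product using (Σ; ∃; _×_; _,_)
open import Data.Sum using (_⊎_)
open import Relation.Nullary using (¬_)
open import Relation.Binary using (Decidable)
open import Relation.Binary.PropositionalEquality using (_≡_; _≢_)
open import Function.Definitions using (Injective)

record Graph : Set₁ where
  field
    n      : ℕ
    _~_    : Fin n → Fin n → Set
    adj?   : Decidable _~_
    sym    : ∀ {u v} → u ~ v → v ~ u
    irrefl : ∀ {u} → ¬ (u ~ u)

module _ (G : Graph) where
  open Graph G

  V : Set
  V = Fin n

  data Walk (E : V → V → Set) (P : V → Set) : V → V → Set where
    here : ∀ {u} → P u → Walk E P u u
    step : ∀ {u w v} → P u → E u w → Walk E P w v → Walk E P u v

  _≁_ : V → V → Set
  u ≁ v = u ≢ v × ¬ (u ~ v)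

  CoConnected : Subset n → Set
  CoConnected X = (∃ λ v → v ∈ X) × (∀ u v → u ∈ X → v ∈ X → Walk _≁_ (_∈ X) u v)

  Clique : (V → Set) → Set
  Clique S = ∀ u v → S u → S v → u ≢ v → u ~ v

  InC : Subset n → V → Set
  InC X v = v ∉ X × (∀ u → u ∈ X → u ~ v)

  InN : (V → Set) → V → Set
  InN R v = ¬ R v × (∃ λ u → R u × u ~ v)

  Outside : Subset n → V → Set
  Outside T v = v ∉ T × ¬ InC T v

  Interesting : Subset n → Set
  Interesting T = (∃ λ v → v ∈ T) × CoConnected T × ¬ Clique (InC T)

  IsChordlessPath : ∀ {m} → (Fin m → V) → Set
  IsChordlessPath {m} p =
    Injective _≡_ _≡_ p ×
    (∀ i j → (p i ~ p j → (toℕ j ≡ suc (toℕ i) ⊎ toℕ i ≡ suc (toℕ j)))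
           × ((toℕ j ≡ suc (toℕ i) ⊎ toℕ i ≡ suc (toℕ j)) → p i ~ p j))

  -- A T-outer path: chordless path with at least one interior vertex
  -- (positions 0 .. k+2), both ends in C(T), interior in V \ (T ∪ C(T)).
  OuterPath : Subset n → Set
  OuterPath T =
    Σ ℕ λ k → Σ (Fin (suc (suc (suc k))) → V) λ p →
      IsChordlessPath p ×
      InC T (p Data.Fin.zero) ×
      InC T (p (fromℕ (suc (suc k)))) ×
      (∀ i → toℕ i ≢ 0 → i ≢ fromℕ (suc (suc k)) → Outside T (p i))

  IsComponent : Subset n → (V → Set) → Set
  IsComponent T R =
    (∃ λ v → R v) ×
    (∀ v → R v → Outside T v) ×
    (∀ u v → R u → R v → Walk _~_ R u v) ×
    (∀ u v → R u → Outside T v → u ~ v → R v)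

{-# OPTIONS --safe #-}
module Submission where

-- If p₀ p₁ … p_{k+2} is a T-outer path, its interior is a walk in
-- G[V ∖ (T ∪ C(T))] and so lies in a single component R; the ends p₀ and
-- p_{k+2} are then two vertices of N(R) ∩ C(T), non-adjacent since the path is
-- chordless. Conversely, for non-adjacent a, b ∈ N(R) ∩ C(T), a walk from a
-- through R to b shortcuts to a chordless path whose interior lies in R, and
-- which has an interior vertex because a ≁ b. Extracting a and b from
-- "N(R) ∩ C(T) is not a clique" needs membership in R to be decidable: this is
-- reachability in a finite graph, decidable because shortcut walks have at
-- most n vertices.

open import Defs
open import Data.Nat using (ℕ; zero; suc; _≤_; _≤′_; ≤′-refl; ≤′-step)
import Data.Nat.Properties as ℕ
open import Data.Fin as Fin using (Fin; toℕ; fromℕ; inject₁)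
import Data.Fin.Properties as Fin
open import Data.Fin.Subset using (Subset)
import Data.Fin.Subset.Properties as Subset
open import Data.Product using (Σ; ∃; ∃₂; _×_; _,_; proj₁; proj₂)
open import Data.Sum as Sum using (_⊎_; inj₁; inj₂)
open import Data.Empty using (⊥-elim)
open import Data.Unit using (⊤; tt)
open import Data.List using (List; []; _∷_; length; lookup)
open import Data.List.Relation.Unary.All as All using (All; []; _∷_)
open import Data.List.Relation.Unary.Any as Any using (Any; here; there)
open import Data.List.Membership.Propositional.Properties using (∈-lookup)
open import Relation.Nullary using (¬_; Dec; yes; no)
open import Relation.Nullary.Decidable using (_×-dec_; _⊎-dec_; _→-dec_; ¬?; map′; decidable-stable)
open import Relation.Binary.PropositionalEquality using (_≡_; _≢_; refl; sym; trans; cong; subst)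
open import Function.Bundles using (_⇔_; mk⇔)

module _ (G : Graph) where
  open Graph G renaming (sym to ~-sym)

  module _ {E : V G → V G → Set} {P : V G → Set} where

    snoc : ∀ {u v w} → Walk G E P u v → E v w → P w → Walk G E P u w
    snoc (here pu) e pw = step pu e (here pw)
    snoc (step pu e′ w) e pw = step pu e′ (snoc w e pw)

    _++ʷ_ : ∀ {u v w} → Walk G E P u v → Walk G E P v w → Walk G E P u w
    here _ ++ʷ w′ = w′
    step pu e w ++ʷ w′ = step pu e (w ++ʷ w′)

    startsIn : ∀ {u v} → Walk G E P u v → P u
    startsIn (here pu) = pu
    startsIn (step pu _ _) = pu

    endsIn : ∀ {u v} → Walk G E P u v → P v
    endsIn (here pv) = pv
    endsIn (step _ _ w) = endsIn w

    weaken : ∀ {Q : V G → Set} → (∀ {x} → P x → Q x) → ∀ {u v} → Walk G E P u v → Walk G E Q u v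
    weaken P⊆Q (here pu) = here (P⊆Q pu)
    weaken P⊆Q (step pu e w) = step (P⊆Q pu) e (weaken P⊆Q w)

    reachable-walk : ∀ {c u v} → Walk G E P c u → Walk G E P u v → Walk G E (Walk G E P c) u v
    reachable-walk c⇝u (here _) = here c⇝u
    reachable-walk c⇝u (step _ e w) = step c⇝u e (reachable-walk (snoc c⇝u e (startsIn w)) w)

  reverse : ∀ {P u v} → Walk G _~_ P u v → Walk G _~_ P v u
  reverse (here pu) = here pu
  reverse (step pu e w) = snoc (reverse w) (~-sym e) pu

  walk-along : ∀ {P m} (p : Fin (suc m) → V G) → (∀ i → p (inject₁ i) ~ p (Fin.suc i)) →
               (∀ i → P (p i)) → Walk G _~_ P (p Fin.zero) (p (fromℕ m))
  walk-along {m = zero} p adj P-p = here (P-p Fin.zero)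
  walk-along {m = suc m} p adj P-p =
    step (P-p Fin.zero) (adj Fin.zero) (walk-along (λ i → p (Fin.suc i)) (λ i → adj (Fin.suc i)) (λ i → P-p (Fin.suc i)))

  Consecutive : ∀ {m} → Fin m → Fin m → Set
  Consecutive i j = toℕ j ≡ suc (toℕ i) ⊎ toℕ i ≡ suc (toℕ j)

  Consecutive-pred : ∀ {m} {i j : Fin m} → Consecutive (Fin.suc i) (Fin.suc j) → Consecutive i j
  Consecutive-pred = Sum.map ℕ.suc-injective ℕ.suc-injective

  IsChordlessPath⇒step : ∀ {m} {p : Fin (suc m) → V G} → IsChordlessPath G p →
                         ∀ i → p (inject₁ i) ~ p (Fin.suc i)
  IsChordlessPath⇒step (_ , adj) i = proj₂ (adj (inject₁ i) (Fin.suc i)) (inj₁ (cong suc (sym (Fin.toℕ-inject₁ i))))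

  Near : V G → V G → Set
  Near x z = x ≡ z ⊎ x ~ z

  near? : ∀ x z → Dec (Near x z)
  near? x z = (x Fin.≟ z) ⊎-dec adj? x z

  Chordless : List (V G) → Set
  Chordless [] = ⊤
  Chordless (x ∷ []) = ⊤
  Chordless (x ∷ y ∷ ys) = x ~ y × All (_≁_ G x) ys × Chordless (y ∷ ys)

  endOf : V G → List (V G) → V G
  endOf x [] = x
  endOf x (y ∷ ys) = endOf y ys

  Chordless-tail : ∀ {x} l → Chordless (x ∷ l) → Chordless l
  Chordless-tail [] _ = tt
  Chordless-tail (y ∷ ys) (_ , _ , c) = c

  Chordless-head∉ : ∀ {x} l → Chordless (x ∷ l) → All (x ≢_) l
  Chordless-head∉ [] _ = []
  Chordless-head∉ (y ∷ ys) (x~y , x≁ys , _) = (λ { refl → irrefl x~y }) ∷ All.map proj₁ x≁ys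

  ¬Any⇒All≁ : ∀ {x} l → ¬ Any (Near x) l → All (_≁_ G x) l
  ¬Any⇒All≁ [] _ = []
  ¬Any⇒All≁ (z ∷ zs) ¬near = ((λ x≡z → ¬near (here (inj₁ x≡z))) , (λ x~z → ¬near (here (inj₂ x~z)))) ∷
                              ¬Any⇒All≁ zs (λ near → ¬near (there near))

  -- Prepend x, then jump straight to the last vertex of the path near x.
  cons-shortcut : ∀ {P : V G → Set} x y ys → Chordless (y ∷ ys) → Any (Near x) (y ∷ ys) → All P (y ∷ ys) →
                  ∃ λ l → Chordless (x ∷ l) × endOf x l ≡ endOf y ys × All P l
  cons-shortcut x y [] _ (here (inj₁ refl)) _ = [] , tt , refl , []
  cons-shortcut x y [] _ (here (inj₂ x~y)) Py = y ∷ [] , (x~y , [] , tt) , refl , Py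
  cons-shortcut x y (y′ ∷ ys) c near Pys with Any.any? (near? x) (y′ ∷ ys) | near
  ... | yes near′ | _ = cons-shortcut x y′ ys (proj₂ (proj₂ c)) near′ (All.tail Pys)
  ... | no _ | here (inj₁ refl) = y′ ∷ ys , c , refl , All.tail Pys
  ... | no ¬near | here (inj₂ x~y) = y ∷ y′ ∷ ys , (x~y , ¬Any⇒All≁ _ ¬near , c) , refl , Pys
  ... | no ¬near | there near′ = ⊥-elim (¬near near′)

  walk⇒chordless : ∀ {P u v} → Walk G _~_ P u v → ∃ λ l → Chordless (u ∷ l) × endOf u l ≡ v × All P l
  walk⇒chordless (here _) = [] , tt , refl , []
  walk⇒chordless (step {u} {c} _ u~c w) with walk⇒chordless w
  ... | l , chordless , end , Pl with cons-shortcut u c l chordless (here (inj₂ u~c)) (startsIn w ∷ Pl)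
  ... | l′ , chordless′ , end′ , Pl′ = l′ , chordless′ , trans end′ end , Pl′

  lookup-endOf : ∀ x l → lookup (x ∷ l) (fromℕ (length l)) ≡ endOf x l
  lookup-endOf x [] = refl
  lookup-endOf x (y ∷ ys) = lookup-endOf y ys

  lookup-injective : ∀ l → Chordless l → ∀ {i j} → lookup l i ≡ lookup l j → i ≡ j
  lookup-injective (x ∷ l) c {Fin.zero} {Fin.zero} _ = refl
  lookup-injective (x ∷ l) c {Fin.zero} {Fin.suc j} eq = ⊥-elim (All.lookup (Chordless-head∉ l c) (∈-lookup j) eq)
  lookup-injective (x ∷ l) c {Fin.suc i} {Fin.zero} eq = ⊥-elim (All.lookup (Chordless-head∉ l c) (∈-lookup i) (sym eq))
  lookup-injective (x ∷ l) c {Fin.suc i} {Fin.suc j} eq = cong Fin.suc (lookup-injective l (Chordless-tail l c) eq)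

  head-adjacent⇒zero : ∀ x l → Chordless (x ∷ l) → ∀ j → x ~ lookup l j → toℕ j ≡ 0
  head-adjacent⇒zero x (y ∷ ys) _ Fin.zero _ = refl
  head-adjacent⇒zero x (y ∷ ys) (_ , x≁ys , _) (Fin.suc j) x~ = ⊥-elim (proj₂ (All.lookup x≁ys (∈-lookup j)) x~)

  lookup-adjacent⇒consecutive : ∀ l → Chordless l → ∀ i j → lookup l i ~ lookup l j → Consecutive i j
  lookup-adjacent⇒consecutive (x ∷ l) c Fin.zero Fin.zero x~x = ⊥-elim (irrefl x~x)
  lookup-adjacent⇒consecutive (x ∷ l) c Fin.zero (Fin.suc j) x~ = inj₁ (cong suc (head-adjacent⇒zero x l c j x~))
  lookup-adjacent⇒consecutive (x ∷ l) c (Fin.suc i) Fin.zero ~x = inj₂ (cong suc (head-adjacent⇒zero x l c i (~-sym ~x)))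
  lookup-adjacent⇒consecutive (x ∷ l) c (Fin.suc i) (Fin.suc j) adj =
    Sum.map (cong suc) (cong suc) (lookup-adjacent⇒consecutive l (Chordless-tail l c) i j adj)

  consecutive⇒lookup-adjacent : ∀ l → Chordless l → ∀ i j → Consecutive i j → lookup l i ~ lookup l j
  consecutive⇒lookup-adjacent (x ∷ y ∷ ys) (x~y , _) Fin.zero (Fin.suc Fin.zero) _ = x~y
  consecutive⇒lookup-adjacent (x ∷ y ∷ ys) (x~y , _) (Fin.suc Fin.zero) Fin.zero _ = ~-sym x~y
  consecutive⇒lookup-adjacent (x ∷ l) c (Fin.suc i) (Fin.suc j) ij =
    consecutive⇒lookup-adjacent l (Chordless-tail l c) i j (Consecutive-pred ij)
  consecutive⇒lookup-adjacent (x ∷ l) c Fin.zero Fin.zero (inj₁ ())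
  consecutive⇒lookup-adjacent (x ∷ l) c Fin.zero Fin.zero (inj₂ ())
  consecutive⇒lookup-adjacent (x ∷ y ∷ ys) c Fin.zero (Fin.suc (Fin.suc j)) (inj₁ ())
  consecutive⇒lookup-adjacent (x ∷ y ∷ ys) c Fin.zero (Fin.suc (Fin.suc j)) (inj₂ ())
  consecutive⇒lookup-adjacent (x ∷ y ∷ ys) c (Fin.suc (Fin.suc i)) Fin.zero (inj₁ ())
  consecutive⇒lookup-adjacent (x ∷ y ∷ ys) c (Fin.suc (Fin.suc i)) Fin.zero (inj₂ ())

  Chordless⇒IsChordlessPath : ∀ l → Chordless l → IsChordlessPath G (lookup l)
  Chordless⇒IsChordlessPath l c =
    lookup-injective l c , λ i j → lookup-adjacent⇒consecutive l c i j , consecutive⇒lookup-adjacent l c i j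

  Chordless⇒length≤ : ∀ l → Chordless l → length l ≤ n
  Chordless⇒length≤ l c = ℕ.≮⇒≥ λ n<l →
    let i , j , i<j , same = Fin.pigeonhole n<l (lookup l) in Fin.<⇒≢ i<j (lookup-injective l c same)

  module Reachability {Q : V G → Set} (Q? : ∀ v → Dec (Q v)) where

    WalkWithin : ℕ → V G → V G → Set
    WalkWithin zero u v = u ≡ v × Q u
    WalkWithin (suc k) u v = WalkWithin zero u v ⊎ ∃ λ w → Q u × u ~ w × WalkWithin k w v

    walkWithin? : ∀ k u v → Dec (WalkWithin k u v)
    walkWithin? zero u v = (u Fin.≟ v) ×-dec Q? u
    walkWithin? (suc k) u v =
      walkWithin? zero u v ⊎-dec Fin.any? (λ w → Q? u ×-dec adj? u w ×-dec walkWithin? k w v)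

    within⇒walk : ∀ k {u v} → WalkWithin k u v → Walk G _~_ Q u v
    within⇒walk zero (refl , Qu) = here Qu
    within⇒walk (suc k) (inj₁ r) = within⇒walk zero r
    within⇒walk (suc k) (inj₂ (w , Qu , u~w , r)) = step Qu u~w (within⇒walk k r)

    within-suc : ∀ k {u v} → WalkWithin k u v → WalkWithin (suc k) u v
    within-suc zero r = inj₁ r
    within-suc (suc k) (inj₁ r) = inj₁ r
    within-suc (suc k) (inj₂ (w , Qu , u~w , r)) = inj₂ (w , Qu , u~w , within-suc k r)

    within-mono : ∀ {k m} → k ≤′ m → ∀ {u v} → WalkWithin k u v → WalkWithin m u v
    within-mono ≤′-refl r = r
    within-mono (≤′-step k≤m) r = within-suc _ (within-mono k≤m r)

    chordless⇒within : ∀ {x} l → Q x → Chordless (x ∷ l) → All Q l → WalkWithin (length l) x (endOf x l)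
    chordless⇒within [] Qx _ _ = refl , Qx
    chordless⇒within (y ∷ ys) Qx (x~y , _ , c) (Qy ∷ Qys) = inj₂ (y , Qx , x~y , chordless⇒within ys Qy c Qys)

    walk⇒within : ∀ {u v} → Walk G _~_ Q u v → WalkWithin n u v
    walk⇒within {u} w with walk⇒chordless w
    ... | l , c , refl , Ql =
      within-mono (ℕ.≤⇒≤′ (ℕ.<⇒≤ (Chordless⇒length≤ (u ∷ l) c))) (chordless⇒within l (startsIn w) c Ql)

    walk? : ∀ u v → Dec (Walk G _~_ Q u v)
    walk? u v = map′ (within⇒walk n) walk⇒within (walkWithin? n u v)

  inC? : ∀ T v → Dec (InC G T v)
  inC? T v = ¬? (v Subset.∈? T) ×-dec Fin.all? (λ u → (u Subset.∈? T) →-dec adj? u v)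

  outside? : ∀ T v → Dec (Outside G T v)
  outside? T v = ¬? (v Subset.∈? T) ×-dec ¬? (inC? T v)

  component-closed : ∀ {T R} → IsComponent G T R → ∀ {s v} → R s → Walk G _~_ (Outside G T) s v → R v
  component-closed _ Rs (here _) = Rs
  component-closed comp@(_ , _ , _ , closed) Rs (step _ e w) = component-closed comp (closed _ _ Rs (startsIn w) e) w

  component? : ∀ {T R} → IsComponent G T R → ∀ v → Dec (R v)
  component? {T} comp@((r₀ , Rr₀) , R⊆outside , connected , _) v =
    map′ (component-closed comp Rr₀) (λ Rv → weaken (λ {x} → R⊆outside x) (connected r₀ v Rr₀ Rv))
         (Reachability.walk? (outside? T) r₀ v)

  boundary? : ∀ {T R} → IsComponent G T R → ∀ v → Dec (InN G R v × InC G T v)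
  boundary? {T} comp v =
    (¬? (component? comp v) ×-dec Fin.any? (λ u → component? comp u ×-dec adj? u v)) ×-dec inC? T v

  ¬Clique⇒nonadjacent : ∀ {S : V G → Set} → (∀ v → Dec (S v)) → ¬ Clique G S →
                        ∃₂ λ a b → S a × S b × _≁_ G a b
  ¬Clique⇒nonadjacent S? ¬clique
    with Fin.any? (λ a → Fin.any? (λ b → S? a ×-dec S? b ×-dec ¬? (a Fin.≟ b) ×-dec ¬? (adj? a b)))
  ... | yes (a , b , Sa , Sb , a≁b) = a , b , Sa , Sb , a≁b
  ... | no none = ⊥-elim (¬clique λ u v Su Sv u≢v →
                    decidable-stable (adj? u v) λ ¬u~v → none (u , v , Su , Sv , u≢v , ¬u~v))

  reachable-component : ∀ {T c} → Outside G T c → IsComponent G T (Walk G _~_ (Outside G T) c)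
  reachable-component {T} {c} O-c =
    (c , here O-c) , (λ _ → endsIn) , connected , (λ _ _ c⇝u O-v u~v → snoc c⇝u u~v O-v)
    where
      R : V G → Set
      R = Walk G _~_ (Outside G T) c
      connected : ∀ u v → R u → R v → Walk G _~_ R u v
      connected _ _ c⇝u c⇝v = reachable-walk c⇝u (reverse c⇝u) ++ʷ reachable-walk (here O-c) c⇝v

  outerPath⇒component : ∀ T → OuterPath G T →
                        Σ (V G → Set) (λ R → IsComponent G T R × ¬ Clique G (λ v → InN G R v × InC G T v))
  outerPath⇒component T (k , p , chordless@(injective , adjacency) , C-start , C-end , interior) =
    R , reachable-component O-c , ends-nonadjacent
    where
      next : ∀ i → p (inject₁ i) ~ p (Fin.suc i)
      next = IsChordlessPath⇒step chordless
      inner : Fin (suc k) → V G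
      inner i = p (Fin.suc (inject₁ i))
      O-inner : ∀ i → Outside G T (inner i)
      O-inner i = interior (Fin.suc (inject₁ i)) (λ ()) (λ eq → Fin.fromℕ≢inject₁ (sym (Fin.suc-injective eq)))
      O-c : Outside G T (inner Fin.zero)
      O-c = O-inner Fin.zero
      R : V G → Set
      R = Walk G _~_ (Outside G T) (inner Fin.zero)
      Boundary : V G → Set
      Boundary v = InN G R v × InC G T v
      boundary : ∀ {x y} → InC G T x → R y → y ~ x → Boundary x
      boundary Cx Ry y~x = ((λ Rx → proj₂ (endsIn Rx) Cx) , (_ , Ry , y~x)) , Cx
      last : Fin (suc (suc (suc k)))
      last = fromℕ (suc (suc k))
      start-boundary : Boundary (p Fin.zero)
      start-boundary = boundary C-start (here O-c) (~-sym (next Fin.zero))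
      end-boundary : Boundary (p last)
      end-boundary = boundary C-end (walk-along inner (λ i → next (Fin.suc (inject₁ i))) O-inner) (next (fromℕ (suc k)))
      ends-nonadjacent : ¬ Clique G Boundary
      ends-nonadjacent clique
        with proj₁ (adjacency Fin.zero last) (clique _ _ start-boundary end-boundary (λ eq → Fin.0≢1+n (injective eq)))
      ... | inj₁ ()
      ... | inj₂ ()

  chordless⇒outerPath : ∀ {T a b} l → Chordless (a ∷ l) → endOf a l ≡ b → _≁_ G a b → InC G T a → InC G T b →
                        All (λ v → v ≡ a ⊎ Outside G T v ⊎ v ≡ b) l → OuterPath G T
  chordless⇒outerPath [] _ a≡b (a≢b , _) _ _ _ = ⊥-elim (a≢b a≡b)
  chordless⇒outerPath (y ∷ []) (a~y , _) y≡b (_ , ¬a~b) _ _ _ = ⊥-elim (¬a~b (subst (_ ~_) y≡b a~y))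
  chordless⇒outerPath {T} {a} {b} l@(y ∷ z ∷ rest) chordless end _ C-a C-b via =
    length rest , lookup (a ∷ l) , Chordless⇒IsChordlessPath (a ∷ l) chordless ,
    C-a , subst (InC G T) (sym last≡b) C-b , interior
    where
      last≡b : lookup (a ∷ l) (fromℕ (length l)) ≡ b
      last≡b = trans (lookup-endOf a l) end
      interior : ∀ i → toℕ i ≢ 0 → i ≢ fromℕ (length l) → Outside G T (lookup (a ∷ l) i)
      interior Fin.zero i≢0 _ = ⊥-elim (i≢0 refl)
      interior (Fin.suc i) _ i≢last with All.lookup via (∈-lookup i)
      ... | inj₁ is-a = ⊥-elim (All.lookup (Chordless-head∉ l chordless) (∈-lookup i) (sym is-a))
      ... | inj₂ (inj₁ outside) = outside
      ... | inj₂ (inj₂ is-b) = ⊥-elim (i≢last (lookup-injective (a ∷ l) chordless (trans is-b (sym last≡b))))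

  component⇒outerPath : ∀ {T R} → IsComponent G T R → ¬ Clique G (λ v → InN G R v × InC G T v) → OuterPath G T
  component⇒outerPath {T} comp@(_ , R⊆outside , connected , _) ¬clique
    with ¬Clique⇒nonadjacent (boundary? comp) ¬clique
  ... | a , b , ((_ , u , Ru , u~a) , C-a) , ((_ , w , Rw , w~b) , C-b) , a≁b
    with walk⇒chordless a⇝b
    where
      a⇝b : Walk G _~_ (λ v → v ≡ a ⊎ Outside G T v ⊎ v ≡ b) a b
      a⇝b = step (inj₁ refl) (~-sym u~a)
              (snoc (weaken (λ {x} Rx → inj₂ (inj₁ (R⊆outside x Rx))) (connected u w Ru Rw)) w~b (inj₂ (inj₂ refl)))
  ... | l , chordless , end , via = chordless⇒outerPath l chordless end a≁b C-a C-b via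

lemma9 : (G : Graph) (T : Subset (Graph.n G)) → Interesting G T →
    OuterPath G T ⇔ Σ (V G → Set) (λ R → IsComponent G T R × ¬ Clique G (λ v → InN G R v × InC G T v))
lemma9 G T _ = mk⇔ (outerPath⇒component G T) (λ (_ , comp , ¬clique) → component⇒outerPath G comp ¬clique)
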